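{- Let $G$ be a finite graph and $\pi$ a lion strategy that clears $G$. Suppose that at some time $t$ there is a set $S\subseteq W_t$ and a connected component $H$ of $G-S$ with $L_t\cap V_H=\emptyset$. Let $\pi'$ be obtained from $\pi$ by adding a remote contamination of every vertex of $H$ at time $t$. Then $\pi'$ also clears $G$.
   Context: Lions and contamination game on a finite graph $G=(V,E)$, $N(v)$ the neighbours of $v$. A lion strategy with $k\ge1$ lions: initial positions $p_i(0)$, and $p_i(t)\in\{p_i(t-1)\}\cup N(p_i(t-1))$ for $t\ge1$; $L_t=\{p_i(t)\}_i$, $\pi_t=\{(p_i(t-1),p_i(t))\}_i$. Contaminated sets: $W_0=V\setminus L_0$; $W_t=(W_{t-1}\setminus L_t)\cup\{v\in V\setminus L_t:\exists w\in W_{t-1}\cap N(v),\ (v,w)\notin\pi_t,(w,v)\notin\pi_t\}$. The strategy clears $G$ if $W_T=\emptyset$ for some $T$. A remote contamination of vertex $v$ at time $t$ is an auxiliary operation: after computing $W_t$ by the rule, $v$ is added to $W_t$ regardless of lions or neighbours; the run then continues by the same rule with the same lion moves. The modified strategy clears $G$ if its contaminated set is empty at some time. -}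

module Defs where

open import Data.Nat using (ℕ; zero; suc)
open import Data.Fin using (Fin)
open import Data.Product using (Σ; ∃; _×_; _,_)
open import Data.Sum using (_⊎_)
open import Data.Empty using (⊥)
open import Relation.Nullary using (¬_)
open import Relation.Binary.PropositionalEquality using (_≡_)

record Graph : Set₁ where
  field
    n     : ℕ
    Adj   : Fin n → Fin n → Set
    sym   : ∀ {u v} → Adj u v → Adj v u
    irrefl : ∀ {v} → ¬ Adj v v

VSet : Graph → Set₁
VSet G = Fin (Graph.n G) → Set

-- A lion strategy with k ≥ 1 lions (k = suc k').
record Strategy (G : Graph) : Set where
  open Graph G
  field
    k'    : ℕ
    pos   : ℕ → Fin (suc k') → Fin n
    valid : ∀ t i → pos (suc t) i ≡ pos t i ⊎ Adj (pos t i) (pos (suc t) i)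

module _ {G : Graph} (σ : Strategy G) where
  open Graph G
  open Strategy σ

  L : ℕ → VSet G
  L t v = ∃ λ i → pos t i ≡ v

  -- (v , w) ∈ π_{t+1}
  Π : ℕ → Fin n → Fin n → Set
  Π t v w = ∃ λ i → (pos t i ≡ v) × (pos (suc t) i ≡ w)

  -- Contaminated sets of the run with auxiliary remote contaminations:
  -- after W_t has been computed by the rule, the set  extra t  is added.
  Wr : (ℕ → VSet G) → ℕ → VSet G
  Wr extra zero v = (¬ L zero v) ⊎ extra zero v
  Wr extra (suc t) v =
      ((Wr extra t v × ¬ L (suc t) v)
      ⊎ (¬ L (suc t) v × (∃ λ w → Wr extra t w × Adj v w
                                 × ¬ Π t v w × ¬ Π t w v)))
      ⊎ extra (suc t) v

  W : ℕ → VSet G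
  W = Wr (λ _ _ → ⊥)

  remoteAt : ℕ → VSet G → ℕ → VSet G
  remoteAt t H s v = (s ≡ t) × H v

  ClearsWith : (ℕ → VSet G) → Set
  ClearsWith extra = ∃ λ T → ∀ v → ¬ Wr extra T v

  Clears : Set
  Clears = ∃ λ T → ∀ v → ¬ W T v

data Reach (G : Graph) (S : VSet G) : Fin (Graph.n G) → Fin (Graph.n G) → Set where
  here : ∀ {u} → ¬ S u → Reach G S u u
  step : ∀ {u v w} → Reach G S u v → Graph.Adj G v w → ¬ S w → Reach G S u w

-- H is (the vertex set of) a connected component of G - S:
-- the set of vertices reachable in G - S from some vertex u ∉ S.
IsComponent : (G : Graph) → VSet G → VSet G → Set
IsComponent G S H =
  Σ (Fin (Graph.n G)) λ u → ¬ S u × (∀ v → (H v → Reach G S u v) × (Reach G S u v → H v))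

module Submission where

-- Let Ball m be the set of vertices at distance less than m from S along paths through H.
-- No lion is in H ∪ S at time t and lions can enter H only through S, so at time t + m
-- every lion in H ∪ S stands in Ball m. Hence the frontier Ball (m + 1) ∖ Ball m, fed from
-- S ⊆ W_t, is contaminated at time t + m already in the original run, and the modified run
-- is contaminated at time t + m at most on W_{t+m} ∪ (H ∖ Ball (m + 1)). Once the original
-- run is clean at time T, a vertex of H ∖ Ball (T + 1) forces, by connectivity of H, a
-- nonempty frontier at time T + t: with an empty one H would be a lion-free component of G,
-- which is never cleared. Membership in vertex sets is not decidable, so the argument runs
-- in the double-negation monad; the conclusion is a negation, so nothing is lost.

open import Defs
open import Data.Nat using (ℕ; zero; suc; _+_; _≤_; _<_; s≤s; _≤′_; ≤′-refl; ≤′-step)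
open import Data.Nat.Properties using (m≢1+n+m; <-irrefl; ≤-refl; <⇒≤; m≤m+n; ≤⇒≤′)
open import Data.Fin using (Fin)
open import Data.Product using (_×_; _,_; ∃; proj₁; proj₂)
open import Data.Sum using (_⊎_; inj₁; inj₂; [_,_]′)
open import Data.Empty using (⊥; ⊥-elim)
open import Effect.Monad using (RawMonad)
open import Function using (_∘_; id)
open import Level using (0ℓ)
open import Relation.Nullary using (¬_; yes; no; ¬¬-excluded-middle)
open import Relation.Nullary.Negation using (¬¬-Monad; contradiction)
open import Relation.Binary.PropositionalEquality using (refl; sym; subst)

open RawMonad (¬¬-Monad {0ℓ})

module _ {G : Graph} (σ : Strategy G) where
  open Graph G using (Adj) renaming (sym to Adj-sym)
  open Strategy σ

  W⇒¬L : ∀ r {v} → W σ r v → ¬ L σ r v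
  W⇒¬L zero (inj₁ ¬l) = ¬l
  W⇒¬L (suc r) (inj₁ (inj₁ (_ , ¬l))) = ¬l
  W⇒¬L (suc r) (inj₁ (inj₂ (¬l , _))) = ¬l

  W-empty-step : ∀ {r} → (∀ v → ¬ W σ r v) → ∀ v → ¬ W σ (suc r) v
  W-empty-step empty v (inj₁ (inj₁ (wv , _))) = empty v wv
  W-empty-step empty v (inj₁ (inj₂ (_ , w , ww , _))) = empty w ww

  W-empty-from : ∀ {T r} → T ≤′ r → (∀ v → ¬ W σ T v) → ∀ v → ¬ W σ r v
  W-empty-from ≤′-refl empty = empty
  W-empty-from (≤′-step T≤r) empty = W-empty-step (W-empty-from T≤r empty)

  mutual
    Wr⊆W : ∀ {extra} r → (∀ s → s ≤ r → ∀ v → ¬ extra s v) →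
           ∀ {v} → Wr σ extra r v → W σ r v
    Wr⊆W r none w =
      [ id , ⊥-elim ∘ none r ≤-refl _ ]′ (Wr⊆W⊎extra r (λ s → none s ∘ <⇒≤) w)

    Wr⊆W⊎extra : ∀ {extra} r → (∀ s → s < r → ∀ v → ¬ extra s v) →
                 ∀ {v} → Wr σ extra r v → W σ r v ⊎ extra r v
    Wr⊆W⊎extra zero _ (inj₁ ¬l) = inj₁ (inj₁ ¬l)
    Wr⊆W⊎extra zero _ (inj₂ e) = inj₂ e
    Wr⊆W⊎extra (suc r) _ (inj₂ e) = inj₂ e
    Wr⊆W⊎extra (suc r) none (inj₁ (inj₁ (wv , ¬l))) =
      inj₁ (inj₁ (inj₁ (Wr⊆W r (λ s → none s ∘ s≤s) wv , ¬l)))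
    Wr⊆W⊎extra (suc r) none (inj₁ (inj₂ (¬l , w , ww , rest))) =
      inj₁ (inj₁ (inj₂ (¬l , w , Wr⊆W r (λ s → none s ∘ s≤s) ww , rest)))

  module _ {P : VSet G} (closed : ∀ {y z} → P y → Adj y z → P z) where

    closed-step : ∀ r i → P (pos r i) → P (pos (suc r) i)
    closed-step r i p = [ (λ stay → subst P (sym stay) p) , closed p ]′ (valid r i)

    closed-step⁻¹ : ∀ r i → P (pos (suc r) i) → P (pos r i)
    closed-step⁻¹ r i p = [ (λ stay → subst P stay p) , closed p ∘ Adj-sym ]′ (valid r i)

    closed-from-start : ∀ r i → P (pos 0 i) → P (pos r i)
    closed-from-start zero i p = p
    closed-from-start (suc r) i p = closed-step r i (closed-from-start r i p)

    closed-to-start : ∀ r i → P (pos r i) → P (pos 0 i)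
    closed-to-start zero i p = p
    closed-to-start (suc r) i p = closed-to-start r i (closed-step⁻¹ r i p)

    closed-lion-free : ∀ {t} → (∀ v → ¬ (L σ t v × P v)) → ∀ r v → ¬ (L σ r v × P v)
    closed-lion-free {t} free r v ((i , refl) , p) =
      free (pos t i) ((i , refl) , closed-from-start t i (closed-to-start r i p))

  lion-free⊆W : ∀ {P : VSet G} → (∀ r v → ¬ (L σ r v × P v)) → ∀ r {v} → P v → W σ r v
  lion-free⊆W free zero p = inj₁ (λ l → free 0 _ (l , p))
  lion-free⊆W free (suc r) p = inj₁ (inj₁ (lion-free⊆W free r p , λ l → free (suc r) _ (l , p)))

Reach-end∉ : ∀ {G S a b} → Reach G S a b → ¬ S b
Reach-end∉ (here ∉S) = ∉S
Reach-end∉ (step _ _ ∉S) = ∉S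

module Component {G : Graph} {S H : VSet G} (comp : IsComponent G S H) where
  open Graph G using (Adj) renaming (sym to Adj-sym)

  root : Fin (Graph.n G)
  root = proj₁ comp

  Reach⇒H : ∀ {v} → Reach G S root v → H v
  Reach⇒H {v} = proj₂ (proj₂ (proj₂ comp) v)

  H⇒Reach : ∀ {v} → H v → Reach G S root v
  H⇒Reach {v} = proj₁ (proj₂ (proj₂ comp) v)

  root∈H : H root
  root∈H = Reach⇒H (here (proj₁ (proj₂ comp)))

  H⇒¬S : ∀ {v} → H v → ¬ S v
  H⇒¬S = Reach-end∉ ∘ H⇒Reach

  H-closed : ∀ {v w} → H v → Adj v w → ¬ S w → H w
  H-closed h adj ∉S = Reach⇒H (step (H⇒Reach h) adj ∉S)

  H-neighbour : ∀ {x v} → H v → Adj x v → ¬ ¬ (H x ⊎ S x)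
  H-neighbour h adj = do
    no ∉S ← ¬¬-excluded-middle
      where yes s → pure (inj₂ s)
    pure (inj₁ (H-closed h (Adj-sym adj) ∉S))

  H-spread : ∀ {Q : VSet G} → (∀ {y z} → H y → Adj y z → Q y → Q z) →
             ∀ {v w} → H v → Q v → H w → Q w
  H-spread {Q} spread hv qv hw = from-root (H⇒Reach hw)
    where
    to-root : ∀ {y} → Reach G S root y → Q y → Q root
    to-root (here _) q = q
    to-root (step r adj ∉S) q = to-root r (spread (Reach⇒H (step r adj ∉S)) (Adj-sym adj) q)

    from-root : ∀ {y} → Reach G S root y → Q y
    from-root (here _) = to-root (H⇒Reach hv) qv
    from-root (step r adj _) = spread (Reach⇒H r) adj (from-root r)

  Ball : ℕ → VSet G
  Ball zero v = ⊥
  Ball (suc m) v = S v ⊎ (H v × ∃ λ x → Ball m x × Adj x v)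

  Ball-mono : ∀ m {v} → Ball m v → Ball (suc m) v
  Ball-mono (suc m) (inj₁ s) = inj₁ s
  Ball-mono (suc m) (inj₂ (h , x , b , adj)) = inj₂ (h , x , Ball-mono m b , adj)

module Recontamination {G : Graph} (σ : Strategy G) (clears : Clears σ) (t : ℕ)
  {S H : VSet G} (S⊆W : ∀ v → S v → W σ t v) (comp : IsComponent G S H)
  (H-lion-free : ∀ v → ¬ (L σ t v × H v)) where

  open Graph G using (Adj) renaming (sym to Adj-sym)
  open Strategy σ
  open Component comp

  H-not-closed : ¬ (∀ {y z} → H y → Adj y z → H z)
  H-not-closed closed =
    proj₂ clears root (lion-free⊆W σ (closed-lion-free σ closed H-lion-free) (proj₁ clears) root∈H)

  ¬Ball⇒¬L : ∀ m {v} → ¬ Ball m v → H v ⊎ S v → ¬ L σ (m + t) v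
  ¬Ball⇒¬L zero _ (inj₁ h) l = H-lion-free _ (l , h)
  ¬Ball⇒¬L zero _ (inj₂ s) l = W⇒¬L σ t (S⊆W _ s) l
  ¬Ball⇒¬L (suc m) ¬b hs (i , refl) with valid (m + t) i | hs
  ... | inj₁ stay | _ = ¬Ball⇒¬L m (¬b ∘ Ball-mono m) hs (i , sym stay)
  ... | inj₂ move | inj₂ s = ¬b (inj₁ s)
  ... | inj₂ move | inj₁ h = H-neighbour h move λ hs′ →
    ¬Ball⇒¬L m (λ b → ¬b (inj₂ (h , _ , b , move))) hs′ (i , refl)

  frontier⊆W : ∀ m {v} → Ball (suc m) v → ¬ Ball m v → ¬ ¬ W σ (m + t) v
  frontier⊆W zero (inj₁ s) _ = pure (S⊆W _ s)
  frontier⊆W (suc m) (inj₁ s) ¬b = contradiction (inj₁ s) ¬b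
  frontier⊆W (suc m) {v} (inj₂ (h , x , bx , adj)) ¬b = do
    no ¬bx ← ¬¬-excluded-middle
      where yes bx′ → contradiction (inj₂ (h , x , bx′ , adj)) ¬b
    wx ← frontier⊆W m bx ¬bx
    pure (inj₁ (inj₂ (¬lv , x , wx , Adj-sym adj , ¬moved-out , ¬moved-in)))
    where
    ¬lv : ¬ L σ (suc m + t) v
    ¬lv = ¬Ball⇒¬L (suc m) ¬b (inj₁ h)

    ¬moved-out : ¬ Π σ (m + t) v x
    ¬moved-out (i , at-v , _) = ¬Ball⇒¬L m (¬b ∘ Ball-mono m) (inj₁ h) (i , at-v)

    ¬moved-in : ¬ Π σ (m + t) x v
    ¬moved-in (i , _ , at-v) = ¬lv (i , at-v)

  frontier-exists : ∀ j {v} → H v → ¬ Ball j v → ¬ ¬ ∃ λ x → Ball (suc j) x × ¬ Ball j x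
  frontier-exists j hv ¬bv no-frontier = H-not-closed closed
    where
    stable : ∀ {x} → Ball (suc j) x → ¬ ¬ Ball j x
    stable b ¬b = no-frontier (_ , b , ¬b)

    spread : ∀ {y z} → H y → Adj y z → ¬ Ball j y → ¬ Ball j z
    spread hy adj ¬by bz = stable (inj₂ (hy , _ , bz , Adj-sym adj)) ¬by

    closed : ∀ {y z} → H y → Adj y z → H z
    closed hy adj = H-closed hy adj λ sz →
      stable (inj₁ sz) (spread hy adj (H-spread spread hv ¬bv hy))

  W′ : ℕ → VSet G
  W′ = Wr σ (remoteAt σ t H)

  advance : ∀ m {v} → H v → ¬ Ball (suc m) v →
            ¬ ¬ (W σ (suc m + t) v ⊎ (H v × ¬ Ball (suc (suc m)) v))
  advance m h ¬b = do
    yes b ← ¬¬-excluded-middle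
      where no ¬b′ → pure (inj₂ (h , ¬b′))
    inj₁ <$> frontier⊆W (suc m) b ¬b

  W′⊆W∪H∖Ball : ∀ m {v} → W′ (m + t) v → ¬ ¬ (W σ (m + t) v ⊎ (H v × ¬ Ball (suc m) v))
  W′⊆W∪H∖Ball zero w′ with Wr⊆W⊎extra σ t (λ s s<t _ (s≡t , _) → <-irrefl s≡t s<t) w′
  ... | inj₁ w = pure (inj₁ w)
  ... | inj₂ (_ , h) = pure (inj₂ (h , [ H⇒¬S h , (λ { (_ , _ , () , _) }) ]′))
  W′⊆W∪H∖Ball (suc m) (inj₂ (e , _)) = contradiction (sym e) (m≢1+n+m t)
  W′⊆W∪H∖Ball (suc m) (inj₁ (inj₁ (w′v , ¬l))) = do
    inj₂ (h , ¬b) ← W′⊆W∪H∖Ball m w′v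
      where inj₁ wv → pure (inj₁ (inj₁ (inj₁ (wv , ¬l))))
    advance m h ¬b
  W′⊆W∪H∖Ball (suc m) {v} (inj₁ (inj₂ (¬l , w , w′w , adj , rest))) = do
    inj₂ (hw , ¬bw) ← W′⊆W∪H∖Ball m w′w
      where inj₁ ww → pure (inj₁ (inj₁ (inj₂ (¬l , w , ww , adj , rest))))
    no ¬bv ← ¬¬-excluded-middle
      where yes bv → do
        wv ← frontier⊆W m bv (λ b → ¬bw (inj₂ (hw , v , b , adj)))
        pure (inj₁ (inj₁ (inj₁ (wv , ¬l))))
    inj₁ hv ← H-neighbour hw adj
      where inj₂ sv → contradiction (inj₁ sv) ¬bv
    advance m hv ¬bv

lemma11 : (G : Graph) (σ : Strategy G) → Clears σ →
    (t : ℕ) (S H : VSet G) →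
    (∀ v → S v → W σ t v) →
    IsComponent G S H →
    (∀ v → ¬ (L σ t v × H v)) →
    ClearsWith σ (remoteAt σ t H)
lemma11 G σ clears t S H S⊆W comp H-lion-free = T + t , cleared
  where
  open Component comp
  open Recontamination σ clears t S⊆W comp H-lion-free

  T : ℕ
  T = proj₁ clears

  W-empty : ∀ v → ¬ W σ (T + t) v
  W-empty = W-empty-from σ (≤⇒≤′ (m≤m+n T t)) (proj₂ clears)

  cleared : ∀ v → ¬ W′ (T + t) v
  cleared v w′ = W′⊆W∪H∖Ball T w′ λ where
    (inj₁ w) → W-empty v w
    (inj₂ (h , ¬b)) → frontier-exists T h (¬b ∘ Ball-mono T) λ (x , b , ¬b′) →
      frontier⊆W T b ¬b′ (W-empty x)
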